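{- The index type $J$ of the theory CaTT has decidable equality (for all $j,j'\in J$ one can construct an element of $(j=j')+\neg(j=j')$), and for every $j\in J$, if $C_j\vdash T_j$ is derivable in CaTT then $\dim_C(C_j)\le\dim(T_j)$.
   Context: Meta-theory: Martin-Löf type theory without axiom K. Glob: raw types $*$, $\Rightarrow(A,t,u)$, raw terms $\mathrm{Var}\,x$ ($x\in\mathbb{N}$), raw contexts finite lists of pairs $(x,A)$ ($\mathrm{nil}$ empty, $L::p$ appends $p$, $\ell(L)$ length, $\mathrm{drop}(L)$ removes the last appended element). Ps-judgements on raw Glob contexts: (pss) $\mathrm{nil}::(0,*)\vdash_{ps}0:*$; (psd) from $\Gamma\vdash_{ps}f:\Rightarrow(A,\mathrm{Var}\,x,\mathrm{Var}\,y)$ derive $\Gamma\vdash_{ps}y:A$; (pse) from $\Gamma\vdash_{ps}x:A$, $l=\ell(\Gamma)$, derive $(\Gamma::(l,A))::(l+1,\Rightarrow(A,\mathrm{Var}\,x,\mathrm{Var}\,l))\vdash_{ps}l+1:\Rightarrow(A,\mathrm{Var}\,x,\mathrm{Var}\,l)$; (ps) from $\Gamma\vdash_{ps}x:*$ derive $\Gamma\vdash_{ps}$. Dimensions: $\dim(*)=0$, $\dim(\Rightarrow(A,t,u))=\dim A+1$, $\dim_C(\Gamma)$ = max of $\dim A$ over $(x,A)\in\Gamma$. For a derivation $d$ of $\Gamma\vdash_{ps}x:A$ and $i\in\mathbb{N}$, lists $\mathrm{src}_i(d),\mathrm{tgt}_i(d)$ of naturals: for (pss), both are $\mathrm{nil}$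 if $i=0$ and $[0]$ otherwise; for (psd) from $d'$, equal to those of $d'$; for (pse) from $d':\Gamma\vdash_{ps}x:A$ with $l=\ell(\Gamma)$: if $i\le\dim A+1$ then $\mathrm{src}_i(d)=\mathrm{src}_i(d')$, and $\mathrm{tgt}_i(d)=\mathrm{drop}(\mathrm{tgt}_i(d'))::l$ if $i=\dim A+1$, $=\mathrm{tgt}_i(d')$ otherwise; if $i>\dim A+1$ then $\mathrm{src}_i(d)=\mathrm{src}_i(d')::l::(l+1)$ and $\mathrm{tgt}_i(d)=\mathrm{tgt}_i(d')::l::(l+1)$. For a ps-context $(\Gamma,\mathrm{ps}(d))$, $\mathrm{src}(\Gamma)$ / $\mathrm{tgt}(\Gamma)$ is the set of elements of $\mathrm{src}_{\dim_C\Gamma}(d)$ / $\mathrm{tgt}_{\dim_C\Gamma}(d)$. CaTT raw syntax, defined mutually with $J$: raw types $*$, $\Rightarrow(A,t,u)$; raw terms $\mathrm{Var}\,x$ and $c_j(\gamma)$ for $j\in J$ and raw substitution $\gamma$ (finite list of pairs $(x,t)$); raw contexts finite lists of pairs $(x,A)$. Variable sets: $V(*)=\emptyset$, $V(\Rightarrow(A,t,u))=V(A)\cup V(t)\cup V(u)$, $V(\mathrm{Var}\,x)=\{x\}$, $V(c_j(\gamma))$ = union of $V(t)$ over $(x,t)\in\gamma$; $V(\Gamma)$ = set of first components of $\Gamma$. "$A$ is full in $\Gamma$" is the inductive type with constructors: (Cop) if $A=\Rightarrow(B,t,u)$, $\mathrm{src}(\Gamma)=V(B)\cup V(t)$ and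 $\mathrm{tgt}(\Gamma)=V(B)\cup V(u)$ (set equalities); (Ccoh) if $V(\Gamma)=V(A)$. $J$ is the type of tuples $(\Gamma,d,A,w)$ with $\Gamma$ a raw Glob context, $d$ a derivation of $\Gamma\vdash_{ps}$, $A$ a raw CaTT type, $w$ a witness that $A$ is full in $\Gamma$; $C_j=\Gamma$ (viewed as a CaTT raw context) and $T_j=A$. CaTT judgements: the Glob-style rules (ec),(cc),(ob),(ar),(var),(es),(sc) (with the same definitions of substitution, plus $c_j(\gamma)[\delta]=c_j(\gamma\circ\delta)$) together with (tm): from $C_j\vdash T_j$ and $\Delta\vdash\gamma:C_j$ derive $\Delta\vdash c_j(\gamma):T_j[\gamma]$. -}

module Defs where

open import Data.Nat using (ℕ; zero; suc; _⊔_; _≤ᵇ_; _≡ᵇ_)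
open import Data.Bool using (Bool; true; false; if_then_else_)
open import Data.Product using (Σ; _×_; _,_)
open import Data.Unit using (⊤)
open import Relation.Binary.PropositionalEquality using (_≡_)

-- Finite lists where  L ▸ p  appends p at the end (the paper's L::p)

infixl 5 _▸_
data SList (X : Set) : Set where
  nil : SList X
  _▸_ : SList X → X → SList X

len : ∀ {X} → SList X → ℕ
len nil     = 0
len (L ▸ _) = suc (len L)

drop : ∀ {X} → SList X → SList X
drop nil     = nil
drop (L ▸ _) = L

data _∈_ {X : Set} (x : X) : SList X → Set where
  here  : ∀ {L} → x ∈ (L ▸ x)
  there : ∀ {L y} → x ∈ L → x ∈ (L ▸ y)

FSet : Set
FSet = SList ℕ

infixl 4 _∪_
_∪_ : FSet → FSet → FSet
A ∪ nil     = A
A ∪ (B ▸ x) = (A ∪ B) ▸ x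

_⊆_ : FSet → FSet → Set
nil     ⊆ B = ⊤
(A ▸ x) ⊆ B = (A ⊆ B) × (x ∈ B)

_≃ₛ_ : FSet → FSet → Set
A ≃ₛ B = (A ⊆ B) × (B ⊆ A)

data GTm : Set where
  Varᴳ : ℕ → GTm

data GTy : Set where
  ∗ᴳ : GTy
  ⇒ᴳ : GTy → GTm → GTm → GTy

GCtx : Set
GCtx = SList (ℕ × GTy)

dimᴳ : GTy → ℕ
dimᴳ ∗ᴳ         = 0
dimᴳ (⇒ᴳ A _ _) = suc (dimᴳ A)

dimCᴳ : GCtx → ℕ
dimCᴳ nil           = 0
dimCᴳ (Γ ▸ (_ , A)) = dimCᴳ Γ ⊔ dimᴳ A

data _⊢ps_∶_ : GCtx → ℕ → GTy → Set where
  pss : (nil ▸ (0 , ∗ᴳ)) ⊢ps 0 ∶ ∗ᴳ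
  psd : ∀ {Γ f A x y} → Γ ⊢ps f ∶ ⇒ᴳ A (Varᴳ x) (Varᴳ y) → Γ ⊢ps y ∶ A
  pse : ∀ {Γ x A} → Γ ⊢ps x ∶ A →
        ((Γ ▸ (len Γ , A)) ▸ (suc (len Γ) , ⇒ᴳ A (Varᴳ x) (Varᴳ (len Γ))))
          ⊢ps suc (len Γ) ∶ ⇒ᴳ A (Varᴳ x) (Varᴳ (len Γ))

data _⊢ps (Γ : GCtx) : Set where
  ps : ∀ {x} → Γ ⊢ps x ∶ ∗ᴳ → Γ ⊢ps

srcᵢ : ∀ {Γ x A} → Γ ⊢ps x ∶ A → ℕ → SList ℕ
srcᵢ pss zero    = nil
srcᵢ pss (suc i) = nil ▸ 0
srcᵢ (psd d) i   = srcᵢ d i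
srcᵢ (pse {Γ} {x} {A} d) i =
  if i ≤ᵇ suc (dimᴳ A)
  then srcᵢ d i
  else ((srcᵢ d i ▸ len Γ) ▸ suc (len Γ))

tgtᵢ : ∀ {Γ x A} → Γ ⊢ps x ∶ A → ℕ → SList ℕ
tgtᵢ pss zero    = nil
tgtᵢ pss (suc i) = nil ▸ 0
tgtᵢ (psd d) i   = tgtᵢ d i
tgtᵢ (pse {Γ} {x} {A} d) i =
  if i ≤ᵇ suc (dimᴳ A)
  then (if i ≡ᵇ suc (dimᴳ A) then (drop (tgtᵢ d i) ▸ len Γ) else tgtᵢ d i)
  else ((tgtᵢ d i ▸ len Γ) ▸ suc (len Γ))

src : (Γ : GCtx) → Γ ⊢ps → FSet
src Γ (ps d) = srcᵢ d (dimCᴳ Γ)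

tgt : (Γ : GCtx) → Γ ⊢ps → FSet
tgt Γ (ps d) = tgtᵢ d (dimCᴳ Γ)

Vᴳ : GCtx → FSet
Vᴳ nil           = nil
Vᴳ (Γ ▸ (x , _)) = Vᴳ Γ ▸ x

data Ty  : Set
data Tm  : Set
data Sub : Set
data J   : Set
data Full (Γ : GCtx) (d : Γ ⊢ps) : Ty → Set
Vty  : Ty → FSet
Vtm  : Tm → FSet
Vsub : Sub → FSet

data Ty where
  ∗ : Ty
  ⇒ : Ty → Tm → Tm → Ty

data Tm where
  Var : ℕ → Tm
  coh : J → Sub → Tm

infixl 5 _,_↦_
data Sub where
  ⟨⟩    : Sub
  _,_↦_ : Sub → ℕ → Tm → Sub

data J where
  mkJ : (Γ : GCtx) (d : Γ ⊢ps) (A : Ty) (w : Full Γ d A) → J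

data Full Γ d where
  Cop  : ∀ B t u → src Γ d ≃ₛ (Vty B ∪ Vtm t) → tgt Γ d ≃ₛ (Vty B ∪ Vtm u) →
         Full Γ d (⇒ B t u)
  Ccoh : ∀ {A} → Vᴳ Γ ≃ₛ Vty A → Full Γ d A

Vty ∗           = nil
Vty (⇒ A t u)   = (Vty A ∪ Vtm t) ∪ Vtm u
Vtm (Var x)     = nil ▸ x
Vtm (coh _ γ)   = Vsub γ
Vsub ⟨⟩         = nil
Vsub (γ , _ ↦ t) = Vsub γ ∪ Vtm t

CCtx : Set
CCtx = SList (ℕ × Ty)

dim : Ty → ℕ
dim ∗         = 0
dim (⇒ A _ _) = suc (dim A)

⟦_⟧ty : GTy → Ty
⟦ ∗ᴳ ⟧ty                   = ∗
⟦ ⇒ᴳ A (Varᴳ x) (Varᴳ y) ⟧ty = ⇒ ⟦ A ⟧ty (Var x) (Var y)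

⟦_⟧ctx : GCtx → CCtx
⟦ nil ⟧ctx         = nil
⟦ Γ ▸ (x , A) ⟧ctx = ⟦ Γ ⟧ctx ▸ (x , ⟦ A ⟧ty)

Γof : J → GCtx
Γof (mkJ Γ _ _ _) = Γ

C : J → CCtx
C j = ⟦ Γof j ⟧ctx

T : J → Ty
T (mkJ _ _ A _) = A

-- value of variable x under γ (last binding of x); Var x if x is unbound
lookupₛ : Sub → ℕ → Tm
_[_]ty : Ty → Sub → Ty
_[_]tm : Tm → Sub → Tm
_∘ₛ_   : Sub → Sub → Sub

lookupₛ ⟨⟩ x          = Var x
lookupₛ (γ , y ↦ t) x = if x ≡ᵇ y then t else lookupₛ γ x

∗ [ γ ]ty         = ∗
⇒ A t u [ γ ]ty   = ⇒ (A [ γ ]ty) (t [ γ ]tm) (u [ γ ]tm)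
Var x [ γ ]tm     = lookupₛ γ x
coh j δ [ γ ]tm   = coh j (δ ∘ₛ γ)
⟨⟩ ∘ₛ γ           = ⟨⟩
(δ , x ↦ t) ∘ₛ γ  = (δ ∘ₛ γ) , x ↦ (t [ γ ]tm)

data ⊢_     : CCtx → Set
data _⊢ty_  : CCtx → Ty → Set
data _⊢_∶_  : CCtx → Tm → Ty → Set
data _⊢s_∶_ : CCtx → Sub → CCtx → Set

data ⊢_ where
  ec : ⊢ nil
  cc : ∀ {Γ A} → Γ ⊢ty A → ⊢ (Γ ▸ (len Γ , A))

data _⊢ty_ where
  ob : ∀ {Γ} → ⊢ Γ → Γ ⊢ty ∗
  ar : ∀ {Γ A t u} → Γ ⊢ t ∶ A → Γ ⊢ u ∶ A → Γ ⊢ty ⇒ A t u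

data _⊢_∶_ where
  var : ∀ {Γ x A} → ⊢ Γ → (x , A) ∈ Γ → Γ ⊢ Var x ∶ A
  tm  : ∀ {Δ γ} (j : J) → C j ⊢ty T j → Δ ⊢s γ ∶ C j → Δ ⊢ coh j γ ∶ (T j [ γ ]ty)

data _⊢s_∶_ where
  es : ∀ {Δ} → ⊢ Δ → Δ ⊢s ⟨⟩ ∶ nil
  sc : ∀ {Δ Γ γ x A t} → Δ ⊢s γ ∶ Γ → ⊢ (Γ ▸ (x , A)) → Δ ⊢ t ∶ (A [ γ ]ty) →
       Δ ⊢s (γ , x ↦ t) ∶ (Γ ▸ (x , A))

{-# OPTIONS --safe #-}
-- J is defined inductive-recursively with the raw syntax, so its equality is
-- decided by one structural recursion through types, terms, substitutions and J.  The ps-derivation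
-- and the fullness witness inside an element of J are compared in the total space over their
-- indices, which have decidable equality; Hedberg's theorem (UIP for such types) then brings the
-- comparison back to the fibre.
--
-- In a derivable judgement every variable occurring in a type A, or in a term of
-- type A, is declared with a type of dimension at most dim A; in a substitution into Γ the bound is
-- dimC Γ.  For a coherence c_j(γ) these meet because dimC (C j) ≤ dim (T j), which is the theorem
-- for the smaller derivation of C j ⊢ T j, so everything is one simultaneous induction.  If T j is
-- full by (Ccoh), every variable of C j occurs in T j.  If by (Cop), T j = ⇒ B t u and the source
-- of a ps-context in its top dimension contains a variable of dimension dimC − 1, which occurs in B
-- or t and therefore has dimension at most dim B.
module Submission where

open import Defs
open import Data.Nat using (ℕ; zero; suc; _≤_; _<_; z≤n; s≤s; _⊔_; _≤ᵇ_; _≡ᵇ_; _≤?_; _≟_)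
open import Data.Nat.Properties
open import Data.Bool using (true; false) renaming (T to IsTrue)
open import Data.Product using (Σ; _×_; _,_)
open import Data.Product.Properties using (,-injectiveʳ-UIP) renaming (≡-dec to ×-≡-dec)
open import Data.Sum using (_⊎_; inj₁; inj₂)
open import Data.Sum.Properties using (inj₁-injective; inj₂-injective) renaming (≡-dec to ⊎-≡-dec)
import Data.Unit.Properties as Unit
open import Data.Empty using (⊥-elim)
open import Function using (_∘_)
open import Relation.Nullary using (yes; no; Dec)
open import Relation.Nullary.Reflects using (ofʸ)
open import Relation.Nullary.Decidable using (map′)
open import Relation.Binary.Definitions using (DecidableEquality)
open import Relation.Binary.PropositionalEquality hiding (J)
open import Axiom.UniquenessOfIdentityProofs using (module Decidable⇒UIP)

,-injectiveʳ-dec : ∀ {A : Set} {B : A → Set} {a} {b c : B a} → DecidableEquality A →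
                   _≡_ {A = Σ A B} (a , b) (a , c) → b ≡ c
,-injectiveʳ-dec _≟_ = ,-injectiveʳ-UIP (Decidable⇒UIP.≡-irrelevant _≟_)

fibre-≡-dec : ∀ {A : Set} {B : A → Set} → DecidableEquality A → DecidableEquality (Σ A B) →
              ∀ {a} → DecidableEquality (B a)
fibre-≡-dec _≟ᴬ_ _≟_ b c = map′ (,-injectiveʳ-dec _≟ᴬ_) (cong (_ ,_)) ((_ , b) ≟ (_ , c))

SList-≡-dec : ∀ {X} → DecidableEquality X → DecidableEquality (SList X)
SList-≡-dec _≟ˣ_ nil      nil        = yes refl
SList-≡-dec _≟ˣ_ nil      (_ ▸ _)    = no λ ()
SList-≡-dec _≟ˣ_ (_ ▸ _)  nil        = no λ ()
SList-≡-dec _≟ˣ_ (L ▸ x) (L′ ▸ x′) with SList-≡-dec _≟ˣ_ L L′ | x ≟ˣ x′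
... | yes refl | yes refl = yes refl
... | no L≢L′  | _        = no λ { refl → L≢L′ refl }
... | _        | no x≢x′  = no λ { refl → x≢x′ refl }

FSet-≡-dec : DecidableEquality FSet
FSet-≡-dec = SList-≡-dec _≟_

GTy-≡-dec : DecidableEquality GTy
GTy-≡-dec ∗ᴳ          ∗ᴳ          = yes refl
GTy-≡-dec ∗ᴳ          (⇒ᴳ _ _ _)  = no λ ()
GTy-≡-dec (⇒ᴳ _ _ _)  ∗ᴳ          = no λ ()
GTy-≡-dec (⇒ᴳ A (Varᴳ x) (Varᴳ y)) (⇒ᴳ A′ (Varᴳ x′) (Varᴳ y′))
  with GTy-≡-dec A A′ | x ≟ x′ | y ≟ y′
... | yes refl | yes refl | yes refl = yes refl
... | no A≢A′  | _        | _        = no λ { refl → A≢A′ refl }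
... | _        | no x≢x′  | _        = no λ { refl → x≢x′ refl }
... | _        | _        | no y≢y′  = no λ { refl → y≢y′ refl }

GCtx-≡-dec : DecidableEquality GCtx
GCtx-≡-dec = SList-≡-dec (×-≡-dec _≟_ GTy-≡-dec)

∈-total-≡-dec : ∀ {X} {L : SList X} → DecidableEquality (Σ X (_∈ L))
∈-total-≡-dec (_ , here)    (_ , here)    = yes refl
∈-total-≡-dec (_ , here)    (_ , there _) = no λ ()
∈-total-≡-dec (_ , there _) (_ , here)    = no λ ()
∈-total-≡-dec (x , there p) (y , there q) with ∈-total-≡-dec (x , p) (y , q)
... | yes refl = yes refl
... | no p≢q   = no λ { refl → p≢q refl }

∈-≡-dec : ∀ {x : ℕ} {L} → DecidableEquality (x ∈ L)
∈-≡-dec = fibre-≡-dec _≟_ ∈-total-≡-dec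

⊆-≡-dec : ∀ {S S′} → DecidableEquality (S ⊆ S′)
⊆-≡-dec {nil}   = Unit._≟_
⊆-≡-dec {S ▸ _} = ×-≡-dec ⊆-≡-dec ∈-≡-dec

≃ₛ-≡-dec : ∀ {S S′} → DecidableEquality (S ≃ₛ S′)
≃ₛ-≡-dec = ×-≡-dec ⊆-≡-dec ⊆-≡-dec

PsJudgement : Set
PsJudgement = Σ (GCtx × ℕ × GTy) λ (Γ , x , A) → Γ ⊢ps x ∶ A

⊢ps∶-≡-dec : ∀ {Γ x A Γ′ x′ A′} (d : Γ ⊢ps x ∶ A) (d′ : Γ′ ⊢ps x′ ∶ A′) →
             Dec (_≡_ {A = PsJudgement} (_ , d) (_ , d′))
⊢ps∶-≡-dec pss     pss      = yes refl
⊢ps∶-≡-dec (psd d) (psd d′) with ⊢ps∶-≡-dec d d′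
... | yes refl = yes refl
... | no d≢d′  = no λ { refl → d≢d′ refl }
⊢ps∶-≡-dec (pse d) (pse d′) with ⊢ps∶-≡-dec d d′
... | yes refl = yes refl
... | no d≢d′  = no λ { refl → d≢d′ refl }
⊢ps∶-≡-dec pss     (psd _)  = no λ ()
⊢ps∶-≡-dec pss     (pse _)  = no λ ()
⊢ps∶-≡-dec (psd _) pss      = no λ ()
⊢ps∶-≡-dec (psd _) (pse _)  = no λ ()
⊢ps∶-≡-dec (pse _) pss      = no λ ()
⊢ps∶-≡-dec (pse _) (psd _)  = no λ ()

⊢ps-≡-dec : ∀ {Γ} → DecidableEquality (Γ ⊢ps)
⊢ps-≡-dec (ps d) (ps d′) with ⊢ps∶-≡-dec d d′
... | yes refl = yes refl
... | no d≢d′  = no λ { refl → d≢d′ refl }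

PsContext : Set
PsContext = Σ GCtx _⊢ps

PsContext-≡-dec : DecidableEquality PsContext
PsContext-≡-dec = ×-≡-dec GCtx-≡-dec ⊢ps-≡-dec

-- A fullness witness with its type index forgotten, so that witnesses can be compared without
-- equality of CaTT types, which is decided only mutually with that of J.
FullData : (Γ : GCtx) → Γ ⊢ps → Set
FullData Γ d = (Σ (FSet × FSet) λ (S , S′) → (src Γ d ≃ₛ S) × (tgt Γ d ≃ₛ S′))
             ⊎ Σ FSet (Vᴳ Γ ≃ₛ_)

fullData : ∀ {Γ d A} → Full Γ d A → FullData Γ d
fullData (Cop _ _ _ s t) = inj₁ (_ , s , t)
fullData (Ccoh v)        = inj₂ (_ , v)

FullData-≡-dec : ∀ {Γ d} → DecidableEquality (FullData Γ d)
FullData-≡-dec = ⊎-≡-dec (×-≡-dec (×-≡-dec FSet-≡-dec FSet-≡-dec) (×-≡-dec ≃ₛ-≡-dec ≃ₛ-≡-dec))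
                         (×-≡-dec FSet-≡-dec ≃ₛ-≡-dec)

fullData-injective : ∀ {Γ d A} (w w′ : Full Γ d A) → fullData w ≡ fullData w′ → w ≡ w′
fullData-injective (Cop B t u _ _) (Cop .B .t .u _ _) e
  with ,-injectiveʳ-dec (×-≡-dec FSet-≡-dec FSet-≡-dec) (inj₁-injective e)
... | refl = refl
fullData-injective (Ccoh _) (Ccoh _) e
  with ,-injectiveʳ-dec FSet-≡-dec (inj₂-injective e)
... | refl = refl
fullData-injective (Cop _ _ _ _ _) (Ccoh _) ()
fullData-injective (Ccoh _) (Cop _ _ _ _ _) ()

psContextOf : J → PsContext
psContextOf (mkJ Γ d _ _) = Γ , d

fullDataOf : J → Σ PsContext λ (Γ , d) → FullData Γ d
fullDataOf (mkJ Γ d _ w) = (Γ , d) , fullData w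

Ty-≡-dec  : DecidableEquality Ty
Tm-≡-dec  : DecidableEquality Tm
Sub-≡-dec : DecidableEquality Sub
J-≡-dec   : DecidableEquality J

Ty-≡-dec ∗         ∗          = yes refl
Ty-≡-dec ∗         (⇒ _ _ _)  = no λ ()
Ty-≡-dec (⇒ _ _ _) ∗          = no λ ()
Ty-≡-dec (⇒ A t u) (⇒ A′ t′ u′) with Ty-≡-dec A A′ | Tm-≡-dec t t′ | Tm-≡-dec u u′
... | yes refl | yes refl | yes refl = yes refl
... | no A≢A′  | _        | _        = no λ { refl → A≢A′ refl }
... | _        | no t≢t′  | _        = no λ { refl → t≢t′ refl }
... | _        | _        | no u≢u′  = no λ { refl → u≢u′ refl }

Tm-≡-dec (Var x)   (Var y)    = map′ (cong Var) (λ { refl → refl }) (x ≟ y)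
Tm-≡-dec (Var _)   (coh _ _)  = no λ ()
Tm-≡-dec (coh _ _) (Var _)    = no λ ()
Tm-≡-dec (coh j γ) (coh j′ γ′) with J-≡-dec j j′ | Sub-≡-dec γ γ′
... | yes refl | yes refl = yes refl
... | no j≢j′  | _        = no λ { refl → j≢j′ refl }
... | _        | no γ≢γ′  = no λ { refl → γ≢γ′ refl }

Sub-≡-dec ⟨⟩          ⟨⟩            = yes refl
Sub-≡-dec ⟨⟩          (_ , _ ↦ _)   = no λ ()
Sub-≡-dec (_ , _ ↦ _) ⟨⟩            = no λ ()
Sub-≡-dec (γ , x ↦ t) (γ′ , x′ ↦ t′) with Sub-≡-dec γ γ′ | x ≟ x′ | Tm-≡-dec t t′
... | yes refl | yes refl | yes refl = yes refl
... | no γ≢γ′  | _        | _        = no λ { refl → γ≢γ′ refl }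
... | _        | no x≢x′  | _        = no λ { refl → x≢x′ refl }
... | _        | _        | no t≢t′  = no λ { refl → t≢t′ refl }

J-≡-dec (mkJ Γ d A w) (mkJ Γ′ d′ A′ w′) with PsContext-≡-dec (Γ , d) (Γ′ , d′)
... | no Γd≢Γ′d′ = no (Γd≢Γ′d′ ∘ cong psContextOf)
... | yes refl with Ty-≡-dec A A′
...   | no A≢A′ = no (A≢A′ ∘ cong T)
...   | yes refl =
  map′ (cong (mkJ Γ d A) ∘ fullData-injective w w′) (,-injectiveʳ-dec PsContext-≡-dec ∘ cong fullDataOf)
       (FullData-≡-dec {Γ} {d} (fullData w) (fullData w′))

∈-∪⁻ : ∀ {y} S S′ → y ∈ (S ∪ S′) → y ∈ S ⊎ y ∈ S′
∈-∪⁻ S nil       y∈         = inj₁ y∈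
∈-∪⁻ S (S′ ▸ _)  here       = inj₂ here
∈-∪⁻ S (S′ ▸ _)  (there y∈) with ∈-∪⁻ S S′ y∈
... | inj₁ y∈S  = inj₁ y∈S
... | inj₂ y∈S′ = inj₂ (there y∈S′)

∈-∪⁺ˡ : ∀ {y S} S′ → y ∈ S → y ∈ (S ∪ S′)
∈-∪⁺ˡ nil      y∈ = y∈
∈-∪⁺ˡ (S′ ▸ _) y∈ = there (∈-∪⁺ˡ S′ y∈)

∈-∪⁺ʳ : ∀ {y} S {S′} → y ∈ S′ → y ∈ (S ∪ S′)
∈-∪⁺ʳ S here       = here
∈-∪⁺ʳ S (there y∈) = there (∈-∪⁺ʳ S y∈)

∈-⊆ : ∀ {y S S′} → S ⊆ S′ → y ∈ S → y ∈ S′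
∈-⊆ {S = _ ▸ _} (_ , y∈S′) here       = y∈S′
∈-⊆ {S = _ ▸ _} (S⊆S′ , _) (there y∈) = ∈-⊆ S⊆S′ y∈

∈-Vᴳ : ∀ {Γ x B} → (x , B) ∈ Γ → x ∈ Vᴳ Γ
∈-Vᴳ here      = here
∈-Vᴳ (there m) = there (∈-Vᴳ m)

∈-⟦⟧ctx : ∀ {Γ y B} → (y , B) ∈ Γ → (y , ⟦ B ⟧ty) ∈ ⟦ Γ ⟧ctx
∈-⟦⟧ctx here      = here
∈-⟦⟧ctx (there m) = there (∈-⟦⟧ctx m)

dimC : CCtx → ℕ
dimC nil           = 0
dimC (Γ ▸ (_ , A)) = dimC Γ ⊔ dim A

dim-⟦⟧ty : ∀ A → dim ⟦ A ⟧ty ≡ dimᴳ A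
dim-⟦⟧ty ∗ᴳ                       = refl
dim-⟦⟧ty (⇒ᴳ A (Varᴳ _) (Varᴳ _)) = cong suc (dim-⟦⟧ty A)

dimC-⟦⟧ctx : ∀ Γ → dimC ⟦ Γ ⟧ctx ≡ dimCᴳ Γ
dimC-⟦⟧ctx nil           = refl
dimC-⟦⟧ctx (Γ ▸ (_ , A)) = cong₂ _⊔_ (dimC-⟦⟧ctx Γ) (dim-⟦⟧ty A)

dim-[] : ∀ A γ → dim (A [ γ ]ty) ≡ dim A
dim-[] ∗         γ = refl
dim-[] (⇒ A _ _) γ = cong suc (dim-[] A γ)

dimCᴳ-lub : ∀ {Γ n} → (∀ {x B} → (x , B) ∈ Γ → dimᴳ B ≤ n) → dimCᴳ Γ ≤ n
dimCᴳ-lub {nil}   bound = z≤n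
dimCᴳ-lub {_ ▸ _} bound = ⊔-lub (dimCᴳ-lub (bound ∘ there)) (bound here)

⊢ps-dim≤dimCᴳ : ∀ {Γ x A} → Γ ⊢ps x ∶ A → dimᴳ A ≤ dimCᴳ Γ
⊢ps-dim≤dimCᴳ pss                 = z≤n
⊢ps-dim≤dimCᴳ (psd d)             = ≤-trans (n≤1+n _) (⊢ps-dim≤dimCᴳ d)
⊢ps-dim≤dimCᴳ (pse {Γ} {A = A} d) = m≤n⊔m (dimCᴳ Γ ⊔ dimᴳ A) (suc (dimᴳ A))

⊔-suc-top : ∀ {k a c} → a ≤ c → c < k → k ≤ (c ⊔ a) ⊔ suc a → k ≡ suc a
⊔-suc-top {k} {a} {c} a≤c c<k k≤ rewrite m≥n⇒m⊔n≡m a≤c with ⊔-sel c (suc a)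
... | inj₁ c⊔1+a≡c   = ⊥-elim (<⇒≱ c<k (subst (k ≤_) c⊔1+a≡c k≤))
... | inj₂ c⊔1+a≡1+a = ≤-antisym (subst (k ≤_) c⊔1+a≡1+a k≤) (≤-<-trans a≤c c<k)

srcᵢ-var-of-dim : ∀ {Γ x A} (d : Γ ⊢ps x ∶ A) k → k ≤ dimCᴳ Γ →
                  Σ ℕ λ y → Σ GTy λ B → y ∈ srcᵢ d (suc k) × (y , B) ∈ Γ × dimᴳ B ≡ k
srcᵢ-var-of-dim pss     zero z≤n = 0 , ∗ᴳ , here , here , refl
srcᵢ-var-of-dim (psd d) k    k≤  = srcᵢ-var-of-dim d k k≤
srcᵢ-var-of-dim (pse {Γ} {x} {A} d) k k≤
  with suc k ≤ᵇ suc (dimᴳ A) | ≤ᵇ-reflects-≤ (suc k) (suc (dimᴳ A))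
... | true | ofʸ (s≤s k≤A) with srcᵢ-var-of-dim d k (≤-trans k≤A (⊢ps-dim≤dimCᴳ d))
...   | y , B , y∈ , decl , dimB = y , B , y∈ , there (there decl) , dimB
srcᵢ-var-of-dim (pse {Γ} {x} {A} d) k k≤ | false | _ with k ≤? dimCᴳ Γ
...   | yes k≤Γ with srcᵢ-var-of-dim d k k≤Γ
...     | y , B , y∈ , decl , dimB = y , B , there (there y∈) , there (there decl) , dimB
srcᵢ-var-of-dim (pse {Γ} {x} {A} d) k k≤ | false | _ | no k≰Γ =
  suc (len Γ) , ⇒ᴳ A (Varᴳ x) (Varᴳ (len Γ)) , here , here ,
  sym (⊔-suc-top (⊢ps-dim≤dimCᴳ d) (≰⇒> k≰Γ) k≤)

srcᵢ-dim-bound : ∀ {Γ x A n} (d : Γ ⊢ps x ∶ A) i → i ≤ suc (dimCᴳ Γ) →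
                 (∀ {y B} → y ∈ srcᵢ d i → (y , B) ∈ Γ → dimᴳ B ≤ n) → i ≤ suc n
srcᵢ-dim-bound d zero    _         _     = z≤n
srcᵢ-dim-bound d (suc k) (s≤s k≤) bound with srcᵢ-var-of-dim d k k≤
... | _ , _ , y∈ , decl , refl = s≤s (bound y∈ decl)

⊢ty-ctx : ∀ {Γ A} → Γ ⊢ty A → ⊢ Γ
⊢tm-ctx : ∀ {Γ t A} → Γ ⊢ t ∶ A → ⊢ Γ
⊢s-ctx  : ∀ {Δ γ Γ} → Δ ⊢s γ ∶ Γ → ⊢ Δ
⊢ty-ctx (ob ⊢Γ)     = ⊢Γ
⊢ty-ctx (ar t _)    = ⊢tm-ctx t
⊢tm-ctx (var ⊢Γ _)  = ⊢Γ
⊢tm-ctx (tm _ _ γ)  = ⊢s-ctx γ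
⊢s-ctx (es ⊢Δ)      = ⊢Δ
⊢s-ctx (sc γ _ _)   = ⊢s-ctx γ

declared-<len : ∀ {Γ x A} → ⊢ Γ → (x , A) ∈ Γ → x < len Γ
declared-<len (cc _) here      = ≤-refl
declared-<len (cc D) (there m) = m≤n⇒m≤1+n (declared-<len (⊢ty-ctx D) m)

-- The names are kept apart (x ≡ y) so that matching on membership needs no K.
declaration-unique : ∀ {Γ x y A B} → ⊢ Γ → (x , A) ∈ Γ → (y , B) ∈ Γ → x ≡ y → A ≡ B
declaration-unique (cc _) here      here      _    = refl
declaration-unique (cc D) here      (there m) refl = ⊥-elim (<-irrefl refl (declared-<len (⊢ty-ctx D) m))
declaration-unique (cc D) (there m) here      refl = ⊥-elim (<-irrefl refl (declared-<len (⊢ty-ctx D) m))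
declaration-unique (cc D) (there m) (there n) x≡y  = declaration-unique (⊢ty-ctx D) m n x≡y

data _∈V_[_] (y : ℕ) (S : FSet) (γ : Sub) : Set where
  via : ∀ {x} → x ∈ S → y ∈ Vtm (lookupₛ γ x) → y ∈V S [ γ ]

∈V-mono : ∀ {y γ S S′} → (∀ {x} → x ∈ S → x ∈ S′) → y ∈V S [ γ ] → y ∈V S′ [ γ ]
∈V-mono S⊆S′ (via x∈ y∈) = via (S⊆S′ x∈) y∈

Vty-[] : ∀ A γ {y} → y ∈ Vty (A [ γ ]ty) → y ∈V Vty A [ γ ]
Vtm-[] : ∀ t γ {y} → y ∈ Vtm (t [ γ ]tm) → y ∈V Vtm t [ γ ]
Vsub-∘ : ∀ δ γ {y} → y ∈ Vsub (δ ∘ₛ γ) → y ∈V Vsub δ [ γ ]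
Vty-[] ∗         γ ()
Vty-[] (⇒ A t u) γ y∈ with ∈-∪⁻ (Vty (A [ γ ]ty) ∪ Vtm (t [ γ ]tm)) (Vtm (u [ γ ]tm)) y∈
... | inj₂ y∈u = ∈V-mono (∈-∪⁺ʳ (Vty A ∪ Vtm t)) (Vtm-[] u γ y∈u)
... | inj₁ y∈At with ∈-∪⁻ (Vty (A [ γ ]ty)) (Vtm (t [ γ ]tm)) y∈At
...   | inj₁ y∈A = ∈V-mono (∈-∪⁺ˡ (Vtm u) ∘ ∈-∪⁺ˡ (Vtm t)) (Vty-[] A γ y∈A)
...   | inj₂ y∈t = ∈V-mono (∈-∪⁺ˡ (Vtm u) ∘ ∈-∪⁺ʳ (Vty A)) (Vtm-[] t γ y∈t)
Vtm-[] (Var x)   γ y∈ = via here y∈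
Vtm-[] (coh _ δ) γ y∈ = Vsub-∘ δ γ y∈
Vsub-∘ ⟨⟩          γ ()
Vsub-∘ (δ , _ ↦ t) γ y∈ with ∈-∪⁻ (Vsub (δ ∘ₛ γ)) (Vtm (t [ γ ]tm)) y∈
... | inj₁ y∈δ = ∈V-mono (∈-∪⁺ˡ (Vtm t)) (Vsub-∘ δ γ y∈δ)
... | inj₂ y∈t = ∈V-mono (∈-∪⁺ʳ (Vsub δ)) (Vtm-[] t γ y∈t)

lookupₛ-⊆-Vsub : ∀ {Δ γ Γ x B y} → Δ ⊢s γ ∶ Γ → (x , B) ∈ Γ →
                 y ∈ Vtm (lookupₛ γ x) → y ∈ Vsub γ
lookupₛ-⊆-Vsub {x = x} (sc {γ = γ} {x = z} {t = t} ⊢γ _ _) x∈ y∈ with x ≡ᵇ z in eq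
... | true  = ∈-∪⁺ʳ (Vsub γ) y∈
... | false = ∈-∪⁺ˡ (Vtm t) (lookupₛ-⊆-Vsub ⊢γ (declared-below x∈) y∈)
  where
    declared-below : ∀ {Γ B A} → (x , B) ∈ (Γ ▸ (z , A)) → (x , B) ∈ Γ
    declared-below here      = ⊥-elim (subst IsTrue eq (≡⇒≡ᵇ z z refl))
    declared-below (there m) = m

DimBounded : CCtx → ℕ → FSet → Set
DimBounded Γ n S = ∀ {y} → y ∈ S → Σ Ty λ B → (y , B) ∈ Γ × dim B ≤ n

DimBounded-∪ : ∀ {Γ n} S {S′} → DimBounded Γ n S → DimBounded Γ n S′ → DimBounded Γ n (S ∪ S′)
DimBounded-∪ S {S′} bound bound′ y∈ with ∈-∪⁻ S S′ y∈
... | inj₁ y∈S  = bound y∈S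
... | inj₂ y∈S′ = bound′ y∈S′

DimBounded-mono : ∀ {Γ m n S} → m ≤ n → DimBounded Γ m S → DimBounded Γ n S
DimBounded-mono m≤n bound y∈ with bound y∈
... | B , decl , dimB≤m = B , decl , ≤-trans dimB≤m m≤n

DimBounded-weaken : ∀ {Γ n S p} → DimBounded Γ n S → DimBounded (Γ ▸ p) n S
DimBounded-weaken bound y∈ with bound y∈
... | B , decl , dimB≤n = B , there decl , dimB≤n

DeclarationsDimBounded : CCtx → Set
DeclarationsDimBounded Γ = ∀ {x B} → (x , B) ∈ Γ → DimBounded Γ (dim B) (Vty B)

declared-dim-bound : ∀ {Γ n S y B} → ⊢ ⟦ Γ ⟧ctx → DimBounded ⟦ Γ ⟧ctx n S →
                     y ∈ S → (y , B) ∈ Γ → dimᴳ B ≤ n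
declared-dim-bound {n = n} {B = B} ⊢Γ bound y∈S decl with bound y∈S
... | B′ , decl′ , dimB′≤n = begin
  dimᴳ B       ≡⟨ dim-⟦⟧ty B ⟨
  dim ⟦ B ⟧ty  ≡⟨ cong dim (declaration-unique ⊢Γ (∈-⟦⟧ctx decl) decl′ refl) ⟩
  dim B′       ≤⟨ dimB′≤n ⟩
  n            ∎
  where open ≤-Reasoning

⊢-decls-bounded    : ∀ {Γ} → ⊢ Γ → DeclarationsDimBounded Γ
⊢ty-decls-bounded  : ∀ {Γ A} → Γ ⊢ty A → DeclarationsDimBounded Γ
⊢tm-decls-bounded  : ∀ {Γ t A} → Γ ⊢ t ∶ A → DeclarationsDimBounded Γ
⊢s-decls-bounded   : ∀ {Δ γ Γ} → Δ ⊢s γ ∶ Γ → DeclarationsDimBounded Δ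
⊢ty-vars-bounded   : ∀ {Γ A} → Γ ⊢ty A → DimBounded Γ (dim A) (Vty A)
⊢tm-vars-bounded   : ∀ {Γ t A} → Γ ⊢ t ∶ A → DimBounded Γ (dim A) (Vty A ∪ Vtm t)
⊢s-vars-bounded    : ∀ {Δ γ Γ} → Δ ⊢s γ ∶ Γ → DimBounded Δ (dimC Γ) (Vsub γ)
dimCᴳ≤dim-T        : (j : J) → C j ⊢ty T j → dimCᴳ (Γof j) ≤ dim (T j)

⊢-decls-bounded (cc ⊢A) here      = DimBounded-weaken (⊢ty-vars-bounded ⊢A)
⊢-decls-bounded (cc ⊢A) (there m) = DimBounded-weaken (⊢ty-decls-bounded ⊢A m)
⊢ty-decls-bounded (ob ⊢Γ)    = ⊢-decls-bounded ⊢Γ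
⊢ty-decls-bounded (ar ⊢t _)  = ⊢tm-decls-bounded ⊢t
⊢tm-decls-bounded (var ⊢Γ _) = ⊢-decls-bounded ⊢Γ
⊢tm-decls-bounded (tm _ _ ⊢γ) = ⊢s-decls-bounded ⊢γ
⊢s-decls-bounded (es ⊢Δ)     = ⊢-decls-bounded ⊢Δ
⊢s-decls-bounded (sc ⊢γ _ _) = ⊢s-decls-bounded ⊢γ

⊢ty-vars-bounded (ob _) ()
⊢ty-vars-bounded (ar {A = A} ⊢t ⊢u) =
  DimBounded-mono (n≤1+n (dim A))
    (DimBounded-∪ (Vty A ∪ _) (⊢tm-vars-bounded ⊢t) (⊢tm-vars-bounded ⊢u ∘ ∈-∪⁺ʳ (Vty A)))

⊢tm-vars-bounded (var {A = A} ⊢Γ decl) =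
  DimBounded-∪ (Vty A) (⊢-decls-bounded ⊢Γ decl) λ { here → A , decl , ≤-refl }
⊢tm-vars-bounded (tm {Δ} {γ} j ⊢Tj ⊢γ) =
  DimBounded-∪ (Vty (T j [ γ ]ty)) (varsγ ∘ fromType) varsγ
  where
    dimC-Cj≤ : dimC (C j) ≤ dim (T j [ γ ]ty)
    dimC-Cj≤ = begin
      dimC (C j)        ≡⟨ dimC-⟦⟧ctx (Γof j) ⟩
      dimCᴳ (Γof j)     ≤⟨ dimCᴳ≤dim-T j ⊢Tj ⟩
      dim (T j)         ≡⟨ dim-[] (T j) γ ⟨
      dim (T j [ γ ]ty) ∎
      where open ≤-Reasoning
    varsγ : DimBounded Δ (dim (T j [ γ ]ty)) (Vsub γ)
    varsγ = DimBounded-mono dimC-Cj≤ (⊢s-vars-bounded ⊢γ)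
    fromType : ∀ {y} → y ∈ Vty (T j [ γ ]ty) → y ∈ Vsub γ
    fromType y∈ with Vty-[] (T j) γ y∈
    ... | via x∈ y∈γx with ⊢ty-vars-bounded ⊢Tj x∈
    ...   | _ , decl , _ = lookupₛ-⊆-Vsub ⊢γ decl y∈γx

⊢s-vars-bounded (es _) ()
⊢s-vars-bounded (sc {Γ = Γ} {γ} {A = A} {t} ⊢γ _ ⊢t) =
  DimBounded-∪ (Vsub γ)
    (DimBounded-mono (m≤m⊔n (dimC Γ) (dim A)) (⊢s-vars-bounded ⊢γ))
    (DimBounded-mono (≤-trans (≤-reflexive (dim-[] A γ)) (m≤n⊔m (dimC Γ) (dim A)))
      (⊢tm-vars-bounded ⊢t ∘ ∈-∪⁺ʳ (Vty (A [ γ ]ty))))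

dimCᴳ≤dim-T (mkJ Γ _ A (Ccoh (Vᴳ⊆VA , _))) ⊢A =
  dimCᴳ-lub λ decl → declared-dim-bound (⊢ty-ctx ⊢A) (⊢ty-vars-bounded ⊢A) (∈-⊆ Vᴳ⊆VA (∈-Vᴳ decl)) decl
dimCᴳ≤dim-T (mkJ Γ (ps d) _ (Cop B t u (src⊆ , _) _)) (ar ⊢t _) =
  srcᵢ-dim-bound d (dimCᴳ Γ) (n≤1+n _) λ y∈ decl →
    declared-dim-bound (⊢tm-ctx ⊢t) (⊢tm-vars-bounded ⊢t) (∈-⊆ src⊆ y∈) decl

mainTheorem17 : DecidableEquality J × ((j : J) → C j ⊢ty T j → dimCᴳ (Γof j) ≤ dim (T j))
mainTheorem17 = J-≡-dec , dimCᴳ≤dim-T
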